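{- Let $n\geq 2$, let $k\in[n]$, and let $H=\{\sigma\in S_n\mid \sigma(k)=k\}$ (the Young subgroup $S_{[n]\setminus\{k\}}\times S_{\{k\}}$ corresponding to the partition $(n-1,1)$). Let $X=\{Ha_1,\dots,Ha_n\}$ be the set of right cosets of $H$ in $S_n$ in some fixed order, and for $g\in S_n$ let $P_g$ be the $n\times n$ matrix whose $(i,j)$ entry is $1$ if $Ha_ig=Ha_j$ and $0$ otherwise. Let $S=\{(i,i+1)\mid 1\leq i\leq n-1\}$, $T=S\cup\{\xi\}$ with $\xi$ the identity permutation, and $A=\sum_{t\in T}P_t$. Then $A$ is conjugate, by a permutation matrix, to the $n\times n$ tridiagonal matrix $M_n$ whose entries are: $(M_n)_{1,1}=(M_n)_{n,n}=n-1$, $(M_n)_{i,i}=n-2$ for $2\leq i\leq n-1$, $(M_n)_{i,i+1}=(M_n)_{i+1,i}=1$ for $1\leq i\leq n-1$, and all other entries $0$.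
   Context: Permutations in $S_n$ (the symmetric group on $[n]=\{1,\dots,n\}$) are multiplied by the convention $(\lambda\cdot\sigma)(i)=\sigma(\lambda(i))$ for all $i\in[n]$. -}

module Defs where

open import Data.Nat using (ℕ; zero; suc; _+_; _∸_; _≡ᵇ_)
open import Data.Bool using (Bool; true; false; if_then_else_; _∨_)
open import Data.Fin using (Fin; toℕ; inject₁)
open import Data.Fin.Permutation using (Permutation′; _⟨$⟩ʳ_; _∘ₚ_; _≈_; id; transpose)
open import Data.List using (List; map; allFin)
open import Data.Nat.ListAction using (sum)
open import Data.Product using (Σ; _×_; ∃)
open import Function.Bundles using (_⇔_)
open import Relation.Binary.PropositionalEquality using (_≡_)
open import Relation.Nullary using (¬_)

Sym : ℕ → Set
Sym n = Permutation′ n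

-- Product with the paper's convention (λ · σ)(i) = σ(λ(i)):
-- (π₁ ∘ₚ π₂) ⟨$⟩ʳ i = π₂ ⟨$⟩ʳ (π₁ ⟨$⟩ʳ i) in the standard library.
infixl 7 _·_
_·_ : ∀ {n} → Sym n → Sym n → Sym n
λ′ · σ = λ′ ∘ₚ σ

InH : ∀ {n} → Fin n → Sym n → Set
InH k σ = σ ⟨$⟩ʳ k ≡ k

-- Subsets of S_n as predicates; equality of permutations is pointwise (_≈_).
SubsetS : ℕ → Set₁
SubsetS n = Sym n → Set

RightCoset : ∀ {n} → Fin n → Sym n → SubsetS n
RightCoset k a x = Σ _ λ h → InH k h × (x ≈ h · a)

_⋆_ : ∀ {n} → SubsetS n → Sym n → SubsetS n
(U ⋆ g) x = Σ _ λ u → U u × (x ≈ u · g)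

_≐_ : ∀ {n} → SubsetS n → SubsetS n → Set
U ≐ V = ∀ x → U x ⇔ V x

IsCosetListing : ∀ {n} → Fin n → (Fin n → Sym n) → Set
IsCosetListing {n} k a =
  (∀ i j → RightCoset k (a i) ≐ RightCoset k (a j) → i ≡ j)
  × (∀ g → ∃ λ i → RightCoset k g ≐ RightCoset k (a i))

IsCosetMatrix : ∀ {n} → Fin n → (Fin n → Sym n) → Sym n → (Fin n → Fin n → ℕ) → Set
IsCosetMatrix k a g P = ∀ i j →
  ((RightCoset k (a i) ⋆ g) ≐ RightCoset k (a j) → P i j ≡ 1)
  × (¬ ((RightCoset k (a i) ⋆ g) ≐ RightCoset k (a j)) → P i j ≡ 0)

_⊕_ : ∀ {n} → (Fin n → Fin n → ℕ) → (Fin n → Fin n → ℕ) → (Fin n → Fin n → ℕ)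
(P ⊕ Q) i j = P i j + Q i j

simpleTransposition : ∀ {m} → Fin m → Sym (suc m)
simpleTransposition i = transpose (inject₁ i) (Data.Fin.suc i)

Amat : ∀ {m} → (Sym (suc m) → Fin (suc m) → Fin (suc m) → ℕ) → Fin (suc m) → Fin (suc m) → ℕ
Amat {m} P i j = P id i j + sum (map (λ s → P (simpleTransposition s) i j) (allFin m))

-- The tridiagonal matrix M_n, n = suc m, 0-based indices 0..m:
-- diagonal: m = n-1 at positions 0 and m, m ∸ 1 = n-2 elsewhere;
-- off-diagonal neighbours: 1; all other entries 0.
Mmat : (m : ℕ) → Fin (suc m) → Fin (suc m) → ℕ
Mmat m i j =
  if toℕ i ≡ᵇ toℕ j
  then (if (toℕ i ≡ᵇ 0) ∨ (toℕ i ≡ᵇ m) then m else m ∸ 1)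
  else (if (suc (toℕ i) ≡ᵇ toℕ j) ∨ (suc (toℕ j) ≡ᵇ toℕ i) then 1 else 0)

{-# OPTIONS --safe #-}
module Submission where

-- Since (h · a)(k) = a(k) for h ∈ H, the coset H a is determined by the label a(k), and the
-- coset H a · g has label g(a(k)).  Ordering the cosets by label therefore turns P_g into the
-- permutation matrix of g, so A = I + Σᵢ P_{(i,i+1)}.  An off-diagonal entry (x, y) of this
-- sum counts the adjacent transpositions swapping x and y: one if |x − y| = 1, none otherwise.
-- A diagonal entry x counts 1 + the adjacent transpositions fixing x, i.e. n − 1 minus the
-- number of i with x ∈ {i, i+1}, which is 1 at the two ends of the path and 2 in between.

open import Defs
open import Data.Nat using (ℕ; zero; suc; _≤_; _<_; _+_; _*_; _∸_; _≡ᵇ_; s≤s)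
open import Data.Nat.Properties
  using (≤∧≢⇒<; ≤-reflexive; *-zeroʳ; *-identityʳ; 1+n≢n; +-commutativeSemigroup)
import Data.Nat.Properties as ℕ
open import Data.Bool using (true; false; if_then_else_; _∨_)
open import Data.Fin using (Fin; toℕ; inject₁)
open import Data.Fin.Properties using (toℕ-injective; toℕ≤pred[n])
import Data.Fin.Properties as Fin
open import Data.Fin.Permutation
  using (_⟨$⟩ʳ_; _⟨$⟩ˡ_; _∘ₚ_; permutation; flip; transpose; inverseˡ; inverseʳ; lift₀-transpose)
import Data.Fin.Permutation as Perm
open import Data.List using (map; allFin; tabulate)
open import Data.List.Properties using (map-cong; map-tabulate)
open import Data.Nat.ListAction using (sum)
open import Data.Product using (Σ-syntax; ∃; _,_; proj₁; proj₂)
open import Function using (_∘_)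
open import Function.Bundles using (_⇔_; mk⇔; Equivalence)
open import Relation.Binary.PropositionalEquality
  using (_≡_; _≢_; refl; sym; trans; cong; cong₂; module ≡-Reasoning)
open import Relation.Nullary using (yes; no; proof; contradiction)
open import Relation.Nullary.Reflects using (Reflects; ofʸ; ofⁿ)
open import Algebra.Properties.CommutativeSemigroup +-commutativeSemigroup using (interchange)

open Equivalence using (to; from)

≡ᵇ-reflects : ∀ x y → Reflects (x ≡ y) (x ≡ᵇ y)
≡ᵇ-reflects x y = proof (x ℕ.≟ y)

δ : ℕ → ℕ → ℕ
δ x y = if x ≡ᵇ y then 1 else 0

δ-refl : ∀ x → δ x x ≡ 1
δ-refl zero    = refl
δ-refl (suc x) = δ-refl x

δ-≢ : ∀ {x y} → x ≢ y → δ x y ≡ 0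
δ-≢ {x} {y} x≢y with x ≡ᵇ y | ≡ᵇ-reflects x y
... | true  | ofʸ x≡y = contradiction x≡y x≢y
... | false | _       = refl

sumBelow : ℕ → (ℕ → ℕ) → ℕ
sumBelow zero    f = 0
sumBelow (suc m) f = f 0 + sumBelow m (f ∘ suc)

sum-map-allFin : ∀ m (f : ℕ → ℕ) → sum (map (f ∘ toℕ) (allFin m)) ≡ sumBelow m f
sum-map-allFin m f = trans (cong sum (map-tabulate {n = m} (λ s → s) (f ∘ toℕ))) (sum-tabulate m f)
  where
  sum-tabulate : ∀ m (f : ℕ → ℕ) → sum (tabulate {n = m} (f ∘ toℕ)) ≡ sumBelow m f
  sum-tabulate zero    f = refl
  sum-tabulate (suc m) f = cong (f 0 +_) (sum-tabulate m (f ∘ suc))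

sumBelow-cong : ∀ m {f g : ℕ → ℕ} → (∀ s → f s ≡ g s) → sumBelow m f ≡ sumBelow m g
sumBelow-cong zero    f≗g = refl
sumBelow-cong (suc m) f≗g = cong₂ _+_ (f≗g 0) (sumBelow-cong m (f≗g ∘ suc))

sumBelow-+ : ∀ m (f g : ℕ → ℕ) → sumBelow m (λ s → f s + g s) ≡ sumBelow m f + sumBelow m g
sumBelow-+ zero    f g = refl
sumBelow-+ (suc m) f g = trans (cong (f 0 + g 0 +_) (sumBelow-+ m (f ∘ suc) (g ∘ suc)))
                               (interchange (f 0) (g 0) _ _)

sumBelow-const : ∀ m c → sumBelow m (λ _ → c) ≡ m * c
sumBelow-const zero    c = refl
sumBelow-const (suc m) c = cong (c +_) (sumBelow-const m c)

sumBelow-δ-< : ∀ {m a} → a < m → sumBelow m (λ s → δ s a) ≡ 1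
sumBelow-δ-< {suc m} {zero}  _         = cong suc (trans (sumBelow-const m 0) (*-zeroʳ m))
sumBelow-δ-< {suc m} {suc a} (s≤s a<m) = sumBelow-δ-< a<m

sumBelow-δ-≥ : ∀ {m a} → m ≤ a → sumBelow m (λ s → δ s a) ≡ 0
sumBelow-δ-≥ {zero}  _         = refl
sumBelow-δ-≥ {suc m} (s≤s m≤a) = sumBelow-δ-≥ m≤a

-- The transposition (s, s+1) of ℕ, by recursion so that it commutes with suc definitionally.
swapAdj : ℕ → ℕ → ℕ
swapAdj zero    zero          = 1
swapAdj zero    (suc zero)    = 0
swapAdj zero    (suc (suc x)) = suc (suc x)
swapAdj (suc s) zero          = zero
swapAdj (suc s) (suc x)       = suc (swapAdj s x)

toℕ-simpleTransposition : ∀ {m} (s : Fin m) x →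
  toℕ (simpleTransposition s ⟨$⟩ʳ x) ≡ swapAdj (toℕ s) (toℕ x)
toℕ-simpleTransposition Fin.zero    Fin.zero                   = refl
toℕ-simpleTransposition Fin.zero    (Fin.suc Fin.zero)         = refl
toℕ-simpleTransposition Fin.zero    (Fin.suc (Fin.suc x))      = refl
toℕ-simpleTransposition (Fin.suc s) Fin.zero                   = refl
toℕ-simpleTransposition (Fin.suc s) (Fin.suc x)                =
  trans (cong toℕ (lift₀-transpose (inject₁ s) (Fin.suc s) (Fin.suc x)))
        (cong suc (toℕ-simpleTransposition s x))

δ-swapAdj-suc : ∀ s x → δ (swapAdj s x) (suc x) ≡ δ s x
δ-swapAdj-suc zero    zero          = refl
δ-swapAdj-suc zero    (suc zero)    = refl
δ-swapAdj-suc zero    (suc (suc x)) = δ-≢ {x} (1+n≢n ∘ sym)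
δ-swapAdj-suc (suc s) zero          = refl
δ-swapAdj-suc (suc s) (suc x)       = δ-swapAdj-suc s x

δ-swapAdj-pred : ∀ s y → δ (swapAdj s (suc y)) y ≡ δ s y
δ-swapAdj-pred zero    zero    = refl
δ-swapAdj-pred zero    (suc y) = δ-≢ {suc y} 1+n≢n
δ-swapAdj-pred (suc s) zero    = refl
δ-swapAdj-pred (suc s) (suc y) = δ-swapAdj-pred s y

δ-swapAdj-far : ∀ s {x y} → x ≢ y → suc x ≢ y → suc y ≢ x → δ (swapAdj s x) y ≡ 0
δ-swapAdj-far zero    {zero}          {zero}        x≢y _     _     = contradiction refl x≢y
δ-swapAdj-far zero    {zero}          {suc zero}    _   sx≢y  _     = contradiction refl sx≢y
δ-swapAdj-far zero    {zero}          {suc (suc y)} _   _     _     = refl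
δ-swapAdj-far zero    {suc zero}      {zero}        _   _     sy≢x  = contradiction refl sy≢x
δ-swapAdj-far zero    {suc zero}      {suc y}       _   _     _     = refl
δ-swapAdj-far zero    {suc (suc x)}   {y}           x≢y _     _     = δ-≢ x≢y
δ-swapAdj-far (suc s) {zero}          {zero}        x≢y _     _     = contradiction refl x≢y
δ-swapAdj-far (suc s) {zero}          {suc y}       _   _     _     = refl
δ-swapAdj-far (suc s) {suc x}         {zero}        _   _     _     = refl
δ-swapAdj-far (suc s) {suc x}         {suc y}       x≢y sx≢y  sy≢x  =
  δ-swapAdj-far s (x≢y ∘ cong suc) (sx≢y ∘ cong suc) (sy≢x ∘ cong suc)

δ-swapAdj-fixed : ∀ s x → δ s x + δ (suc s) x + δ (swapAdj s x) x ≡ 1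
δ-swapAdj-fixed zero    zero          = refl
δ-swapAdj-fixed zero    (suc zero)    = refl
δ-swapAdj-fixed zero    (suc (suc x)) = δ-refl x
δ-swapAdj-fixed (suc s) zero          = refl
δ-swapAdj-fixed (suc s) (suc x)       = δ-swapAdj-fixed s x

fixedPoint-count : ∀ m x {a b} →
  sumBelow m (λ s → δ s x) ≡ a → sumBelow m (λ s → δ (suc s) x) ≡ b →
  a + b + sumBelow m (λ s → δ (swapAdj s x) x) ≡ m
fixedPoint-count m x {a} {b} s≡x-count s+1≡x-count = begin
  a + b + sumBelow m (λ s → δ (swapAdj s x) x)
    ≡⟨ cong₂ (λ u v → u + v + _) (sym s≡x-count) (sym s+1≡x-count) ⟩
  sumBelow m (λ s → δ s x) + sumBelow m (λ s → δ (suc s) x) + sumBelow m (λ s → δ (swapAdj s x) x)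
    ≡⟨ cong (_+ sumBelow m (λ s → δ (swapAdj s x) x)) (sym (sumBelow-+ m _ _)) ⟩
  sumBelow m (λ s → δ s x + δ (suc s) x) + sumBelow m (λ s → δ (swapAdj s x) x)
    ≡⟨ sym (sumBelow-+ m _ _) ⟩
  sumBelow m (λ s → δ s x + δ (suc s) x + δ (swapAdj s x) x)
    ≡⟨ sumBelow-cong m (λ s → δ-swapAdj-fixed s x) ⟩
  sumBelow m (λ _ → 1)
    ≡⟨ sumBelow-const m 1 ⟩
  m * 1
    ≡⟨ *-identityʳ m ⟩
  m ∎
  where open ≡-Reasoning

diagonal-count : ∀ {m} x → 1 ≤ m → x ≤ m →
  suc (sumBelow m (λ s → δ (swapAdj s x) x)) ≡ (if (x ≡ᵇ 0) ∨ (x ≡ᵇ m) then m else m ∸ 1)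
diagonal-count {m} zero    1≤m _   =
  fixedPoint-count m 0 (sumBelow-δ-< 1≤m) (trans (sumBelow-const m 0) (*-zeroʳ m))
diagonal-count {m} (suc x) _   x<m with suc x ≡ᵇ m | ≡ᵇ-reflects (suc x) m
... | true  | ofʸ x+1≡m =
  fixedPoint-count m (suc x) (sumBelow-δ-≥ (≤-reflexive (sym x+1≡m))) (sumBelow-δ-< x<m)
... | false | ofⁿ x+1≢m =
  cong (_∸ 1) (fixedPoint-count m (suc x) (sumBelow-δ-< (≤∧≢⇒< x<m x+1≢m)) (sumBelow-δ-< x<m))

off-diagonal-count : ∀ {m x y} → x ≢ y → x ≤ m → y ≤ m →
  sumBelow m (λ s → δ (swapAdj s x) y) ≡ (if (suc x ≡ᵇ y) ∨ (suc y ≡ᵇ x) then 1 else 0)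
off-diagonal-count {m} {x} {y} x≢y x≤m y≤m with suc x ≡ᵇ y | ≡ᵇ-reflects (suc x) y
... | true  | ofʸ refl = trans (sumBelow-cong m (λ s → δ-swapAdj-suc s x)) (sumBelow-δ-< y≤m)
... | false | ofⁿ x+1≢y with suc y ≡ᵇ x | ≡ᵇ-reflects (suc y) x
...   | true  | ofʸ refl = trans (sumBelow-cong m (λ s → δ-swapAdj-pred s y)) (sumBelow-δ-< x≤m)
...   | false | ofⁿ y+1≢x =
  trans (sumBelow-cong m (λ s → δ-swapAdj-far s x≢y x+1≢y y+1≢x))
        (trans (sumBelow-const m 0) (*-zeroʳ m))

permMatrix : ∀ {n} → Sym n → Fin n → Fin n → ℕ
permMatrix g x y = δ (toℕ (g ⟨$⟩ʳ x)) (toℕ y)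

Amat-cong : ∀ {m} {P Q : Sym (suc m) → Fin (suc m) → Fin (suc m) → ℕ} {i j i′ j′} →
  (∀ g → P g i j ≡ Q g i′ j′) → Amat P i j ≡ Amat Q i′ j′
Amat-cong {m} P≗Q =
  cong₂ _+_ (P≗Q Perm.id) (cong sum (map-cong (P≗Q ∘ simpleTransposition) (allFin m)))

Amat-permMatrix : ∀ {m} → 1 ≤ m → (x y : Fin (suc m)) → Amat permMatrix x y ≡ Mmat m x y
Amat-permMatrix {m} 1≤m x y = begin
  Amat permMatrix x y
    ≡⟨ cong (δ (toℕ x) (toℕ y) +_) (cong sum (map-cong transposition-entry (allFin m))) ⟩
  δ (toℕ x) (toℕ y) + sum (map (λ s → δ (swapAdj (toℕ s) (toℕ x)) (toℕ y)) (allFin m))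
    ≡⟨ cong (δ (toℕ x) (toℕ y) +_) (sum-map-allFin m (λ s → δ (swapAdj s (toℕ x)) (toℕ y))) ⟩
  δ (toℕ x) (toℕ y) + sumBelow m (λ s → δ (swapAdj s (toℕ x)) (toℕ y))
    ≡⟨ entry ⟩
  Mmat m x y ∎
  where
  open ≡-Reasoning
  transposition-entry : ∀ s →
    permMatrix (simpleTransposition s) x y ≡ δ (swapAdj (toℕ s) (toℕ x)) (toℕ y)
  transposition-entry s = cong (λ z → δ z (toℕ y)) (toℕ-simpleTransposition s x)
  entry : δ (toℕ x) (toℕ y) + sumBelow m (λ s → δ (swapAdj s (toℕ x)) (toℕ y)) ≡ Mmat m x y
  entry with toℕ x ≡ᵇ toℕ y | ≡ᵇ-reflects (toℕ x) (toℕ y)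
  ... | true  | ofʸ x≡y =
    trans (cong (λ z → suc (sumBelow m (λ s → δ (swapAdj s (toℕ x)) z))) (sym x≡y))
          (diagonal-count (toℕ x) 1≤m (toℕ≤pred[n] x))
  ... | false | ofⁿ x≢y = off-diagonal-count x≢y (toℕ≤pred[n] x) (toℕ≤pred[n] y)

transpose-⟨$⟩ʳ-left : ∀ {n} (i j : Fin n) → transpose i j ⟨$⟩ʳ i ≡ j
transpose-⟨$⟩ʳ-left i j with i Fin.≟ i
... | yes _   = refl
... | no  i≢i = contradiction refl i≢i

module _ {n} (k : Fin n) where

  ∈RightCoset⇔ : ∀ {a x : Sym n} → RightCoset k a x ⇔ (x ⟨$⟩ʳ k ≡ a ⟨$⟩ʳ k)
  ∈RightCoset⇔ {a} {x} = mk⇔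
    (λ (h , hk≡k , x≈h·a) → trans (x≈h·a k) (cong (a ⟨$⟩ʳ_) hk≡k))
    (λ xk≡ak → x ∘ₚ flip a , trans (cong (a ⟨$⟩ˡ_) xk≡ak) (inverseˡ a) , λ _ → sym (inverseʳ a))

  ∈RightCoset⋆⇔ : ∀ {a g x : Sym n} → (RightCoset k a ⋆ g) x ⇔ (x ⟨$⟩ʳ k ≡ g ⟨$⟩ʳ (a ⟨$⟩ʳ k))
  ∈RightCoset⋆⇔ {a} {g} {x} = mk⇔
    (λ (u , u∈Ha , x≈u·g) → trans (x≈u·g k) (cong (g ⟨$⟩ʳ_) (to (∈RightCoset⇔ {a} {u}) u∈Ha)))
    (λ xk≡gak → x ∘ₚ flip g ,
                from (∈RightCoset⇔ {a} {x ∘ₚ flip g}) (trans (cong (g ⟨$⟩ˡ_) xk≡gak) (inverseˡ g)) ,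
                λ _ → sym (inverseʳ g))

  fibre-≐⇔ : ∀ {U V : SubsetS n} {c d} →
    (∀ x → U x ⇔ (x ⟨$⟩ʳ k ≡ c)) → (∀ x → V x ⇔ (x ⟨$⟩ʳ k ≡ d)) → (U ≐ V) ⇔ (c ≡ d)
  fibre-≐⇔ {c = c} U⇔ V⇔ = mk⇔
    (λ U≐V → trans (sym wk≡c) (to (V⇔ w) (to (U≐V w) (from (U⇔ w) wk≡c))))
    (λ c≡d x → mk⇔ (λ Ux → from (V⇔ x) (trans (to (U⇔ x) Ux) c≡d))
                   (λ Vx → from (U⇔ x) (trans (to (V⇔ x) Vx) (sym c≡d))))
    where
    w : Sym n
    w = transpose k c
    wk≡c : w ⟨$⟩ʳ k ≡ c
    wk≡c = transpose-⟨$⟩ʳ-left k c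

  RightCoset-≐⇔ : ∀ {a b : Sym n} → (RightCoset k a ≐ RightCoset k b) ⇔ (a ⟨$⟩ʳ k ≡ b ⟨$⟩ʳ k)
  RightCoset-≐⇔ {a} {b} = fibre-≐⇔ (λ x → ∈RightCoset⇔ {a} {x}) (λ x → ∈RightCoset⇔ {b} {x})

  RightCoset⋆-≐⇔ : ∀ {a b g : Sym n} →
    ((RightCoset k a ⋆ g) ≐ RightCoset k b) ⇔ (g ⟨$⟩ʳ (a ⟨$⟩ʳ k) ≡ b ⟨$⟩ʳ k)
  RightCoset⋆-≐⇔ {a} {b} {g} = fibre-≐⇔ (λ x → ∈RightCoset⋆⇔ {a} {g} {x}) (λ x → ∈RightCoset⇔ {b} {x})

  cosetLabelling : ∀ {a} → IsCosetListing k a → Σ[ π ∈ Sym n ] (∀ x → a (π ⟨$⟩ʳ x) ⟨$⟩ʳ k ≡ x)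
  cosetLabelling {a} (distinct , covering) =
    permutation index label (λ i → label-injective (label-index (label i))) label-index , label-index
    where
    label index : Fin n → Fin n
    label i = a i ⟨$⟩ʳ k
    index x = proj₁ (covering (transpose k x))
    label-index : ∀ x → label (index x) ≡ x
    label-index x =
      trans (sym (to (RightCoset-≐⇔ {transpose k x} {a (index x)}) (proj₂ (covering (transpose k x)))))
            (transpose-⟨$⟩ʳ-left k x)
    label-injective : ∀ {i j} → label i ≡ label j → i ≡ j
    label-injective ai≡aj = distinct _ _ (from (RightCoset-≐⇔ {a _} {a _}) ai≡aj)

  cosetMatrix≡permMatrix : ∀ {a g P} → IsCosetMatrix k a g P →
    ∀ i j → P i j ≡ permMatrix g (a i ⟨$⟩ʳ k) (a j ⟨$⟩ʳ k)
  cosetMatrix≡permMatrix {a} {g} isP i j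
    with toℕ (g ⟨$⟩ʳ (a i ⟨$⟩ʳ k)) ≡ᵇ toℕ (a j ⟨$⟩ʳ k)
       | ≡ᵇ-reflects (toℕ (g ⟨$⟩ʳ (a i ⟨$⟩ʳ k))) (toℕ (a j ⟨$⟩ʳ k))
  ... | true  | ofʸ eq = proj₁ (isP i j) (from (RightCoset⋆-≐⇔ {a i} {a j} {g}) (toℕ-injective eq))
  ... | false | ofⁿ ne = proj₂ (isP i j) (ne ∘ cong toℕ ∘ to (RightCoset⋆-≐⇔ {a i} {a j} {g}))

lemma3p3 : (m : ℕ) → 1 ≤ m → (k : Fin (suc m))
    → (a : Fin (suc m) → Sym (suc m)) → IsCosetListing k a
    → (P : Sym (suc m) → Fin (suc m) → Fin (suc m) → ℕ)
    → (∀ g → IsCosetMatrix k a g (P g))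
    → ∃ λ (π : Sym (suc m)) → ∀ i j → Amat P (π ⟨$⟩ʳ i) (π ⟨$⟩ʳ j) ≡ Mmat m i j
lemma3p3 m 1≤m k a listing P isP =
  π , λ x y → trans (Amat-cong {P = P} {Q = permMatrix} (entry x y)) (Amat-permMatrix 1≤m x y)
  where
  π : Sym (suc m)
  π = proj₁ (cosetLabelling k {a} listing)
  label-π : ∀ x → a (π ⟨$⟩ʳ x) ⟨$⟩ʳ k ≡ x
  label-π = proj₂ (cosetLabelling k {a} listing)
  entry : ∀ x y g → P g (π ⟨$⟩ʳ x) (π ⟨$⟩ʳ y) ≡ permMatrix g x y
  entry x y g = trans (cosetMatrix≡permMatrix k {a} {g} (isP g) (π ⟨$⟩ʳ x) (π ⟨$⟩ʳ y))
                      (cong₂ (permMatrix g) (label-π x) (label-π y))
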